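{- Let $R$ be a Tate ring with subring $R_0$ and $\varpi\in R_0\cap R^\times$, $R=R_0[\varpi^{ -1}]$, defining its topology. Let $t_1,\dots,t_n\in R$ with $t_1R+\dots+t_nR=R$. For each $i$ let $R[1/t_i]$ be the localization of $R$ at $\{1,t_i,t_i^2,\dots\}$ and $\phi_i:R\to R[1/t_i]$ the natural map. Then $$\bigcap_{i=1}^n\phi_i^{ -1}\bigl(\phi_i(R_0)[t_1/t_i,\dots,t_n/t_i]\bigr)\subseteq R^\circ.$$
   Context: The topology on $R$ has basis $r+\varpi^mR_0$. An element $r\in R$ is power-bounded if there is $N\ge0$ with $r^m\in\varpi^{ -N}R_0$ for all $m\ge 0$; $R^\circ$ is the set of power-bounded elements. -}

module Defs where

open import Level using (Level; _⊔_)
open import Algebra.Bundles using (CommutativeRing)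
open import Data.Nat using (ℕ; zero; suc) renaming (_+_ to _+ℕ_)
open import Data.Fin using (Fin; zero; suc)
open import Data.Product using (Σ; ∃; _×_; _,_)
open import Relation.Unary using (Pred; _∈_)

module _ {c ℓ : Level} (R : CommutativeRing c ℓ) where
  open CommutativeRing R using (Carrier; _≈_; _+_; _*_; -_; _-_; 0#; 1#)

  pow : Carrier → ℕ → Carrier
  pow x zero = 1#
  pow x (suc k) = x * pow x k

  sumᶠ : (n : ℕ) → (Fin n → Carrier) → Carrier
  sumᶠ zero f = 0#
  sumᶠ (suc n) f = f zero + sumᶠ n (λ j → f (suc j))

  record IsSubring {p : Level} (R₀ : Pred Carrier p) : Set (c ⊔ ℓ ⊔ p) where
    field
      resp  : ∀ {x y} → x ≈ y → x ∈ R₀ → y ∈ R₀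
      one   : 1# ∈ R₀
      zero' : 0# ∈ R₀
      plus  : ∀ {x y} → x ∈ R₀ → y ∈ R₀ → (x + y) ∈ R₀
      neg   : ∀ {x} → x ∈ R₀ → (- x) ∈ R₀
      times : ∀ {x y} → x ∈ R₀ → y ∈ R₀ → (x * y) ∈ R₀

  ScaledR₀ : {p : Level} → Pred Carrier p → Carrier → ℕ → Pred Carrier (c ⊔ ℓ ⊔ p)
  ScaledR₀ R₀ ϖinv N r = Σ Carrier λ a → a ∈ R₀ × (r ≈ pow ϖinv N * a)

  PowerBounded : {p : Level} → Pred Carrier p → Carrier → Pred Carrier (c ⊔ ℓ ⊔ p)
  PowerBounded R₀ ϖinv r = Σ ℕ λ N → (m : ℕ) → pow r m ∈ ScaledR₀ R₀ ϖinv N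

  -- Localization R[1/t]: elements are pairs (r , k) standing for r / t^k
  Loc : Set c
  Loc = Carrier × ℕ

  LocEq : Carrier → Loc → Loc → Set ℓ
  LocEq t (r , k) (s , l) =
    Σ ℕ λ m → pow t m * (pow t l * r - pow t k * s) ≈ 0#

  locAdd : Carrier → Loc → Loc → Loc
  locAdd t (r , k) (s , l) = (pow t l * r + pow t k * s , k +ℕ l)

  locMul : Loc → Loc → Loc
  locMul (r , k) (s , l) = (r * s , k +ℕ l)

  φ : Carrier → Loc
  φ r = (r , 0)

  -- the subring φ_i(R₀)[t₁/tᵢ, …, tₙ/tᵢ] of R[1/tᵢ], generated by φ_i(R₀)
  -- and the fractions t_j / t_i (given as representatives; membership is
  -- taken up to LocEq in the preimage below)
  data Gen {p : Level} (R₀ : Pred Carrier p) {n : ℕ} (t : Fin n → Carrier) (i : Fin n)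
       : Loc → Set (c ⊔ p) where
    base : ∀ {a} → a ∈ R₀ → Gen R₀ t i (φ a)
    frac : (j : Fin n) → Gen R₀ t i (t j , 1)
    add  : ∀ {x y} → Gen R₀ t i x → Gen R₀ t i y → Gen R₀ t i (locAdd (t i) x y)
    mul  : ∀ {x y} → Gen R₀ t i x → Gen R₀ t i y → Gen R₀ t i (locMul x y)

  Preimage : {p : Level} → Pred Carrier p → {n : ℕ} → (Fin n → Carrier) → Fin n →
             Pred Carrier (c ⊔ ℓ ⊔ p)
  Preimage R₀ t i x = Σ Loc λ y → Gen R₀ t i y × LocEq (t i) (φ x) y

{-# OPTIONS --safe #-}
module Submission where

open import Defs
open import Level using (Level; _⊔_)
open import Algebra.Bundles using (CommutativeRing)
open import Data.Nat using (ℕ)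
open import Data.Fin using (Fin)
open import Data.Product using (Σ; _×_)
open import Relation.Unary using (Pred; _∈_)

open import Data.Nat as ℕ using (zero; suc; _≤_; _<_; _≤′_; ≤′-refl; ≤′-step; _≤?_)
import Data.Nat.Properties as ℕₚ
open import Data.Fin using (zero; suc)
open import Data.Product using (∃; _,_; proj₁; proj₂)
open import Data.Vec.Functional using (Vector; foldr; updateAt; replicate)
open import Function using (_∘_; id)
open import Relation.Nullary using (yes; no)
open import Relation.Binary.PropositionalEquality as ≡ using (_≡_)

-- Write A_e for the R₀-span of the degree-e monomials in t₁, …, tₙ. That x lies in the
-- i-th preimage means x tᵢᵈ ∈ A_d for some d, which may be chosen independent of i. By
-- pigeonhole every monomial of degree D = n d + 1 is divisible by some tᵢᵈ, so x A_D ⊆ A_D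
-- and hence xᵐ A_D ⊆ A_D for all m. Raising Σ sⱼ tⱼ = 1 to the D-th power gives
-- 1 ∈ ϖ⁻ᴺ A_D for some N, and A_D ⊆ ϖ⁻ᴰᴸ R₀ once every tⱼ ∈ ϖ⁻ᴸ R₀. Hence
-- xᵐ = xᵐ · 1 ∈ ϖ⁻ᴺ⁻ᴰᴸ R₀ for every m.

suc-closed⇒≤-closed : ∀ {q} (Q : Pred ℕ q) → (∀ {d} → Q d → Q (suc d)) →
                      ∀ {d e} → d ≤ e → Q d → Q e
suc-closed⇒≤-closed Q Q-suc d≤e = go (ℕₚ.≤⇒≤′ d≤e)
  where
  go : ∀ {d e} → d ≤′ e → Q d → Q e
  go ≤′-refl        = id
  go (≤′-step d≤′e) = Q-suc ∘ go d≤′e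

common-witness : ∀ {q} n (Q : Fin n → Pred ℕ q) → (∀ i {d} → Q i d → Q i (suc d)) →
                 (∀ i → ∃ (Q i)) → ∃ λ d → ∀ i → Q i d
common-witness zero    Q Q-suc witness = 0 , λ ()
common-witness (suc n) Q Q-suc witness
  with witness zero | common-witness n (Q ∘ suc) (λ i → Q-suc (suc i)) (witness ∘ suc)
... | d₀ , q₀ | d , q = d₀ ℕ.⊔ d , λ where
  zero    → suc-closed⇒≤-closed (Q zero) (Q-suc zero) (ℕₚ.m≤m⊔n d₀ d) q₀
  (suc i) → suc-closed⇒≤-closed (Q (suc i)) (Q-suc (suc i)) (ℕₚ.m≤n⊔m d₀ d) (q i)

∣_∣ : ∀ {m} → Vector ℕ m → ℕ
∣ c ∣ = foldr ℕ._+_ 0 c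

∣updateAt-suc∣ : ∀ {m} (c : Vector ℕ m) j → ∣ updateAt c j suc ∣ ≡ suc ∣ c ∣
∣updateAt-suc∣ c zero    = ≡.refl
∣updateAt-suc∣ c (suc j) =
  ≡.trans (≡.cong (c zero ℕ.+_) (∣updateAt-suc∣ (c ∘ suc) j)) (ℕₚ.+-suc (c zero) _)

∣replicate-0∣ : ∀ m → ∣ replicate m 0 ∣ ≡ 0
∣replicate-0∣ zero    = ≡.refl
∣replicate-0∣ (suc m) = ∣replicate-0∣ m

module Powers {c ℓ} (R : CommutativeRing c ℓ) where
  open CommutativeRing R hiding (zero)
  open import Algebra.Properties.CommutativeSemigroup *-commutativeSemigroup
    using (x∙yz≈y∙zx)
  open import Algebra.Properties.Group +-group using (x∙y⁻¹≈ε⇒x≈y)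
  open import Algebra.Properties.Ring ring using (x[y-z]≈xy-xz)
  open import Relation.Binary.Reasoning.Setoid setoid

  pow-distribˡ-+-* : ∀ a m k → pow R a (m ℕ.+ k) ≈ pow R a m * pow R a k
  pow-distribˡ-+-* a zero    k = sym (*-identityˡ _)
  pow-distribˡ-+-* a (suc m) k = trans (*-congˡ (pow-distribˡ-+-* a m k)) (sym (*-assoc _ _ _))

  pow-1# : ∀ k → pow R 1# k ≈ 1#
  pow-1# zero    = refl
  pow-1# (suc k) = trans (*-identityˡ _) (pow-1# k)

  clear-denominator : ∀ {s x r k} → LocEq R s (φ R x) (r , k) →
                      ∃ λ m → x * pow R s (m ℕ.+ k) ≈ pow R s m * r
  clear-denominator {s} {x} {r} {k} (m , sᵐ[sᵏx-r]≈0) = m , (begin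
    x * pow R s (m ℕ.+ k)          ≈⟨ *-congˡ (pow-distribˡ-+-* s m k) ⟩
    x * (pow R s m * pow R s k)    ≈⟨ x∙yz≈y∙zx x _ _ ⟩
    pow R s m * (pow R s k * x)    ≈⟨ x∙y⁻¹≈ε⇒x≈y _ _ (trans (sym (x[y-z]≈xy-xz _ _ _)) sᵐ[sᵏx-r]≈0) ⟩
    pow R s m * (1# * r)           ≈⟨ *-congˡ (*-identityˡ r) ⟩
    pow R s m * r                  ∎)

module Monomials {c ℓ} (R : CommutativeRing c ℓ) where
  open CommutativeRing R hiding (zero)
  open import Algebra.Properties.CommutativeSemigroup *-commutativeSemigroup using (x∙yz≈y∙xz)

  monomial : ∀ {m} → Vector Carrier m → Vector ℕ m → Carrier
  monomial u c = foldr _*_ 1# (λ j → pow R (u j) (c j))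

  monomial-updateAt-suc : ∀ {m} (u : Vector Carrier m) c j →
                          monomial u (updateAt c j suc) ≈ u j * monomial u c
  monomial-updateAt-suc u c zero    = *-assoc _ _ _
  monomial-updateAt-suc u c (suc j) =
    trans (*-congˡ (monomial-updateAt-suc (u ∘ suc) (c ∘ suc) j)) (x∙yz≈y∙xz _ _ _)

  monomial-replicate-0 : ∀ {m} (u : Vector Carrier m) → monomial u (replicate m 0) ≈ 1#
  monomial-replicate-0 {zero}  u = refl
  monomial-replicate-0 {suc m} u = trans (*-identityˡ _) (monomial-replicate-0 (u ∘ suc))

module Scaling {c ℓ} (R : CommutativeRing c ℓ) (ϖinv : CommutativeRing.Carrier R) where
  open CommutativeRing R hiding (zero)
  open import Algebra.Properties.CommutativeSemigroup *-commutativeSemigroup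
    using (x∙yz≈y∙xz; interchange)
  open Powers R using (pow-distribˡ-+-*)

  -- ScaledR₀ X ϖinv N unfolds to a Σ-type mentioning N only under pow, so Agda never
  -- infers N: callers below supply it explicitly.
  _[1/ϖ] : ∀ {q} → Pred Carrier q → Pred Carrier (c ⊔ ℓ ⊔ q)
  (X [1/ϖ]) z = ∃ λ N → z ∈ ScaledR₀ R X ϖinv N

  module _ {q} {X : Pred Carrier q} where

    scaled-resp : ∀ {N a b} → a ≈ b → a ∈ ScaledR₀ R X ϖinv N → b ∈ ScaledR₀ R X ϖinv N
    scaled-resp a≈b (h , h∈X , a≈) = h , h∈X , trans (sym a≈b) a≈

    scaled-0 : ∀ {a} → a ∈ X → a ∈ ScaledR₀ R X ϖinv 0
    scaled-0 a∈X = _ , a∈X , sym (*-identityˡ _)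

    scaled-+ : (∀ {a b} → a ∈ X → b ∈ X → a + b ∈ X) →
               ∀ {N a b} → a ∈ ScaledR₀ R X ϖinv N → b ∈ ScaledR₀ R X ϖinv N →
               a + b ∈ ScaledR₀ R X ϖinv N
    scaled-+ +-closed (h , h∈X , a≈) (h′ , h′∈X , b≈) =
      h + h′ , +-closed h∈X h′∈X , trans (+-cong a≈ b≈) (sym (distribˡ _ _ _))

    scaled-map : ∀ {q′} {Y : Pred Carrier q′} {x} → (∀ {h} → h ∈ X → x * h ∈ Y) →
                 ∀ {N z} → z ∈ ScaledR₀ R X ϖinv N → x * z ∈ ScaledR₀ R Y ϖinv N
    scaled-map x*X⊆Y (h , h∈X , z≈) =
      _ , x*X⊆Y h∈X , trans (*-congˡ z≈) (x∙yz≈y∙xz _ _ _)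

    scaled-scaled : ∀ {M N z} → z ∈ ScaledR₀ R (ScaledR₀ R X ϖinv M) ϖinv N →
                    z ∈ ScaledR₀ R X ϖinv (N ℕ.+ M)
    scaled-scaled {M} {N} (h , (a , a∈X , h≈) , z≈) =
      a , a∈X , trans (trans z≈ (*-congˡ h≈))
                      (trans (sym (*-assoc _ _ _)) (*-congʳ (sym (pow-distribˡ-+-* ϖinv N M))))

  module _ {qx qy qz} {X : Pred Carrier qx} {Y : Pred Carrier qy} {Z : Pred Carrier qz}
           (XY⊆Z : ∀ {a b} → a ∈ X → b ∈ Y → a * b ∈ Z) where

    scaled-* : ∀ {M N a b} → a ∈ ScaledR₀ R X ϖinv M → b ∈ ScaledR₀ R Y ϖinv N →
               a * b ∈ ScaledR₀ R Z ϖinv (M ℕ.+ N)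
    scaled-* {M} {N} (h , h∈X , a≈) (h′ , h′∈Y , b≈) =
      h * h′ , XY⊆Z h∈X h′∈Y ,
      trans (trans (*-cong a≈ b≈) (interchange _ _ _ _))
            (*-congʳ (sym (pow-distribˡ-+-* ϖinv M N)))

    [1/ϖ]-* : ∀ {a b} → a ∈ X [1/ϖ] → b ∈ Y [1/ϖ] → a * b ∈ Z [1/ϖ]
    [1/ϖ]-* (M , a∈) (N , b∈) = M ℕ.+ N , scaled-* {M} {N} a∈ b∈

  [1/ϖ]-resp : ∀ {q} {X : Pred Carrier q} {a b} → a ≈ b → a ∈ X [1/ϖ] → b ∈ X [1/ϖ]
  [1/ϖ]-resp a≈b (N , a∈) = N , scaled-resp {N = N} a≈b a∈

  [1/ϖ]-pow : ∀ {q} (X : ℕ → Pred Carrier q) → 1# ∈ X 0 →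
              (∀ {e f a b} → a ∈ X e → b ∈ X f → a * b ∈ X (e ℕ.+ f)) →
              ∀ {z} → z ∈ X 1 [1/ϖ] → ∀ k → pow R z k ∈ X k [1/ϖ]
  [1/ϖ]-pow X 1∈X₀ X-* z∈ zero    = 0 , scaled-0 1∈X₀
  [1/ϖ]-pow X 1∈X₀ X-* z∈ (suc k) = [1/ϖ]-* X-* z∈ ([1/ϖ]-pow X 1∈X₀ X-* z∈ k)

  module _ {ϖ : Carrier} (ϖϖinv≈1 : ϖ * ϖinv ≈ 1#) {q} {X : Pred Carrier q}
           (ϖ*-closed : ∀ {h} → h ∈ X → ϖ * h ∈ X) where

    scaled-suc : ∀ {N z} → z ∈ ScaledR₀ R X ϖinv N → z ∈ ScaledR₀ R X ϖinv (suc N)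
    scaled-suc (h , h∈X , z≈) =
      ϖ * h , ϖ*-closed h∈X ,
      trans z≈ (sym (trans (interchange _ _ _ _)
                           (trans (*-congʳ (trans (*-comm _ _) ϖϖinv≈1)) (*-identityˡ _))))

    scaled-raise : ∀ k {N z} → z ∈ ScaledR₀ R X ϖinv N → z ∈ ScaledR₀ R X ϖinv (k ℕ.+ N)
    scaled-raise zero    = id
    scaled-raise (suc k) {N} = scaled-suc {k ℕ.+ N} ∘ scaled-raise k {N}

    module _ (+-closed : ∀ {a b} → a ∈ X → b ∈ X → a + b ∈ X) where

      [1/ϖ]-+ : ∀ {a b} → a ∈ X [1/ϖ] → b ∈ X [1/ϖ] → a + b ∈ X [1/ϖ]
      [1/ϖ]-+ {b = b} (M , a∈) (N , b∈) =
        N ℕ.+ M , scaled-+ +-closed {N ℕ.+ M} (scaled-raise N {M} a∈)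
                    (≡.subst (λ K → b ∈ ScaledR₀ R X ϖinv K) (ℕₚ.+-comm M N) (scaled-raise M {N} b∈))

      [1/ϖ]-sumᶠ : 0# ∈ X → ∀ m (f : Vector Carrier m) → (∀ j → f j ∈ X [1/ϖ]) →
                   sumᶠ R m f ∈ X [1/ϖ]
      [1/ϖ]-sumᶠ 0∈X zero    f f∈ = 0 , scaled-0 0∈X
      [1/ϖ]-sumᶠ 0∈X (suc m) f f∈ = [1/ϖ]-+ (f∈ zero) ([1/ϖ]-sumᶠ 0∈X m (f ∘ suc) (f∈ ∘ suc))

module HomogeneousComponents {c ℓ p} (R : CommutativeRing c ℓ)
  {R₀ : Pred (CommutativeRing.Carrier R) p} (R₀-subring : IsSubring R R₀)
  {n : ℕ} (t : Vector (CommutativeRing.Carrier R) n) where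

  open CommutativeRing R hiding (zero)
  open IsSubring R₀-subring using (one; zero'; plus; times)
  open import Algebra.Properties.CommutativeSemigroup *-commutativeSemigroup
    using (x∙yz≈y∙xz; xy∙z≈y∙xz)
  open import Relation.Binary.Reasoning.Setoid setoid
  open Powers R
  open Monomials R

  -- Homogeneous e is A_e.
  data Homogeneous : ℕ → Pred Carrier (c ⊔ ℓ ⊔ p) where
    scalar      : ∀ {a} → a ∈ R₀ → Homogeneous 0 a
    var*        : ∀ {e h} j → Homogeneous e h → Homogeneous (suc e) (t j * h)
    zero-closed : ∀ {e} → Homogeneous e 0#
    +-closed    : ∀ {e a b} → Homogeneous e a → Homogeneous e b → Homogeneous e (a + b)
    R₀*-closed  : ∀ {e a h} → a ∈ R₀ → Homogeneous e h → Homogeneous e (a * h)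
    resp        : ∀ {e a b} → a ≈ b → Homogeneous e a → Homogeneous e b

  cast-degree : ∀ {e f h} → e ≡ f → Homogeneous e h → Homogeneous f h
  cast-degree ≡.refl h∈ = h∈

  homogeneous-* : ∀ {e f a b} → Homogeneous e a → Homogeneous f b → Homogeneous (e ℕ.+ f) (a * b)
  homogeneous-* (scalar a∈R₀)      b∈ = R₀*-closed a∈R₀ b∈
  homogeneous-* (var* j a∈)        b∈ = resp (sym (*-assoc _ _ _)) (var* j (homogeneous-* a∈ b∈))
  homogeneous-* zero-closed        b∈ = resp (sym (zeroˡ _)) zero-closed
  homogeneous-* (+-closed a∈ a′∈)  b∈ =
    resp (sym (distribʳ _ _ _)) (+-closed (homogeneous-* a∈ b∈) (homogeneous-* a′∈ b∈))
  homogeneous-* (R₀*-closed r∈ a∈) b∈ = resp (sym (*-assoc _ _ _)) (R₀*-closed r∈ (homogeneous-* a∈ b∈))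
  homogeneous-* (resp a≈a′ a∈)     b∈ = resp (*-congʳ a≈a′) (homogeneous-* a∈ b∈)

  homogeneous-pow : ∀ {u} → Homogeneous 1 u → ∀ k → Homogeneous k (pow R u k)
  homogeneous-pow u∈ zero    = scalar one
  homogeneous-pow u∈ (suc k) = homogeneous-* u∈ (homogeneous-pow u∈ k)

  homogeneous-t : ∀ j → Homogeneous 1 (t j)
  homogeneous-t j = resp (*-identityʳ _) (var* j (scalar one))

  homogeneous-monomial : ∀ {m} (u : Vector Carrier m) → (∀ j → Homogeneous 1 (u j)) →
                         ∀ c → Homogeneous ∣ c ∣ (monomial u c)
  homogeneous-monomial {zero}  u u∈ c = scalar one
  homogeneous-monomial {suc m} u u∈ c =
    homogeneous-* (homogeneous-pow (u∈ zero) (c zero)) (homogeneous-monomial (u ∘ suc) (u∈ ∘ suc) (c ∘ suc))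

  Stabilises : Carrier → ℕ → Set (c ⊔ ℓ ⊔ p)
  Stabilises y e = ∀ {h} → Homogeneous e h → Homogeneous e (y * h)

  stabilises-pow : ∀ {y e} → Stabilises y e → ∀ m → Stabilises (pow R y m) e
  stabilises-pow y-stab zero    h∈ = resp (sym (*-identityˡ _)) h∈
  stabilises-pow y-stab (suc m) h∈ = resp (sym (*-assoc _ _ _)) (y-stab (stabilises-pow y-stab m h∈))

  module _ {x : Carrier} {d : ℕ} where

    -- Pigeonhole: a monomial of degree > m d in u₁, …, uₘ contains some uⱼᵈ
    x*monomial-homogeneous : ∀ {m} (u : Vector Carrier m) → (∀ j → Homogeneous 1 (u j)) →
                             (∀ j → Homogeneous d (x * pow R (u j) d)) →
                             ∀ c → m ℕ.* d < ∣ c ∣ → Homogeneous ∣ c ∣ (x * monomial u c)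
    x*monomial-homogeneous {zero}  u u∈ xuᵈ∈ c ()
    x*monomial-homogeneous {suc m} u u∈ xuᵈ∈ c md<∣c∣ with d ≤? c zero
    ... | yes d≤c₀ =
      cast-degree degree-eq
        (resp value-eq (homogeneous-* (xuᵈ∈ zero)
          (homogeneous-* (homogeneous-pow (u∈ zero) k) (homogeneous-monomial (u ∘ suc) (u∈ ∘ suc) (c ∘ suc)))))
      where
      k : ℕ
      k = c zero ℕ.∸ d
      d+k≡c₀ : d ℕ.+ k ≡ c zero
      d+k≡c₀ = ℕₚ.m+[n∸m]≡n d≤c₀
      degree-eq : d ℕ.+ (k ℕ.+ ∣ c ∘ suc ∣) ≡ ∣ c ∣
      degree-eq = ≡.trans (≡.sym (ℕₚ.+-assoc d k _)) (≡.cong (ℕ._+ ∣ c ∘ suc ∣) d+k≡c₀)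
      M′ : Carrier
      M′ = monomial (u ∘ suc) (c ∘ suc)
      value-eq : (x * pow R (u zero) d) * (pow R (u zero) k * M′) ≈ x * monomial u c
      value-eq = begin
        (x * pow R (u zero) d) * (pow R (u zero) k * M′)  ≈⟨ *-assoc _ _ _ ⟩
        x * (pow R (u zero) d * (pow R (u zero) k * M′))  ≈⟨ *-congˡ (sym (*-assoc _ _ _)) ⟩
        x * ((pow R (u zero) d * pow R (u zero) k) * M′)  ≈⟨ *-congˡ (*-congʳ (sym (pow-distribˡ-+-* _ d k))) ⟩
        x * (pow R (u zero) (d ℕ.+ k) * M′)               ≈⟨ *-congˡ (*-congʳ (reflexive (≡.cong (pow R (u zero)) d+k≡c₀))) ⟩
        x * monomial u c                                   ∎
    ... | no d≰c₀ =
      resp (x∙yz≈y∙xz _ _ _)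
        (homogeneous-* (homogeneous-pow (u∈ zero) (c zero))
          (x*monomial-homogeneous (u ∘ suc) (u∈ ∘ suc) (xuᵈ∈ ∘ suc) (c ∘ suc) md<∣c′∣))
      where
      md<∣c′∣ : m ℕ.* d < ∣ c ∘ suc ∣
      md<∣c′∣ = ℕₚ.+-cancelˡ-< d _ _
        (ℕₚ.<-≤-trans md<∣c∣ (ℕₚ.+-monoˡ-≤ ∣ c ∘ suc ∣ (ℕₚ.<⇒≤ (ℕₚ.≰⇒> d≰c₀))))

    module _ (xtᵈ∈ : ∀ j → Homogeneous d (x * pow R (t j) d)) where

      -- The monomial factor tᶜ is what lets the induction pass through var*.
      x*monomial*-homogeneous : ∀ {e h} → Homogeneous e h → ∀ c → n ℕ.* d < ∣ c ∣ ℕ.+ e →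
                                Homogeneous (∣ c ∣ ℕ.+ e) (x * (monomial t c * h))
      x*monomial*-homogeneous (scalar {a} a∈R₀) c nd< =
        cast-degree (≡.sym (ℕₚ.+-identityʳ ∣ c ∣))
          (resp (trans (x∙yz≈y∙xz a x _) (*-congˡ (*-comm a _)))
            (R₀*-closed a∈R₀ (x*monomial-homogeneous t homogeneous-t xtᵈ∈ c
              (≡.subst (n ℕ.* d <_) (ℕₚ.+-identityʳ ∣ c ∣) nd<))))
      x*monomial*-homogeneous (var* {e} j h∈) c nd< =
        cast-degree degree-eq
          (resp (*-congˡ (trans (*-congʳ (monomial-updateAt-suc t c j)) (xy∙z≈y∙xz _ _ _)))
            (x*monomial*-homogeneous h∈ (updateAt c j suc) (≡.subst (n ℕ.* d <_) (≡.sym degree-eq) nd<)))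
        where
        degree-eq : ∣ updateAt c j suc ∣ ℕ.+ e ≡ ∣ c ∣ ℕ.+ suc e
        degree-eq = ≡.trans (≡.cong (ℕ._+ e) (∣updateAt-suc∣ c j)) (≡.sym (ℕₚ.+-suc ∣ c ∣ e))
      x*monomial*-homogeneous zero-closed c nd< =
        resp (sym (trans (*-congˡ (zeroʳ _)) (zeroʳ _))) zero-closed
      x*monomial*-homogeneous (+-closed a∈ b∈) c nd< =
        resp (sym (trans (*-congˡ (distribˡ _ _ _)) (distribˡ _ _ _)))
          (+-closed (x*monomial*-homogeneous a∈ c nd<) (x*monomial*-homogeneous b∈ c nd<))
      x*monomial*-homogeneous (R₀*-closed {a = a} a∈R₀ h∈) c nd< =
        resp (trans (x∙yz≈y∙xz a x _) (*-congˡ (x∙yz≈y∙xz a _ _)))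
          (R₀*-closed a∈R₀ (x*monomial*-homogeneous h∈ c nd<))
      x*monomial*-homogeneous (resp a≈b h∈) c nd< =
        resp (*-congˡ (*-congˡ a≈b)) (x*monomial*-homogeneous h∈ c nd<)

      stabilises-above : ∀ {e} → n ℕ.* d < e → Stabilises x e
      stabilises-above {e} nd<e {h} h∈ =
        resp (*-congˡ (trans (*-congʳ (monomial-replicate-0 t)) (*-identityˡ h)))
          (cast-degree (≡.cong (ℕ._+ e) (∣replicate-0∣ n))
            (x*monomial*-homogeneous h∈ (replicate n 0)
              (≡.subst (λ z → n ℕ.* d < z ℕ.+ e) (≡.sym (∣replicate-0∣ n)) nd<e)))

  numerator-homogeneous : ∀ {i y} → Gen R R₀ t i y → Homogeneous (proj₂ y) (proj₁ y)
  numerator-homogeneous (base a∈R₀) = scalar a∈R₀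
  numerator-homogeneous (frac j)    = homogeneous-t j
  numerator-homogeneous {i} (add {_ , k} {_ , l} g g′) =
    +-closed (cast-degree (ℕₚ.+-comm l k)
               (homogeneous-* (homogeneous-pow (homogeneous-t i) l) (numerator-homogeneous g)))
             (homogeneous-* (homogeneous-pow (homogeneous-t i) k) (numerator-homogeneous g′))
  numerator-homogeneous (mul g g′) = homogeneous-* (numerator-homogeneous g) (numerator-homogeneous g′)

  preimage⇒homogeneous : ∀ {x} i → x ∈ Preimage R R₀ t i →
                          ∃ λ d → Homogeneous d (x * pow R (t i) d)
  preimage⇒homogeneous i ((r , k) , g , φx≈r/tᵢᵏ) with clear-denominator φx≈r/tᵢᵏ
  ... | m , xtᵢᵐ⁺ᵏ≈tᵢᵐr = m ℕ.+ k ,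
    resp (sym xtᵢᵐ⁺ᵏ≈tᵢᵐr) (homogeneous-* (homogeneous-pow (homogeneous-t i) m) (numerator-homogeneous g))

  x*pow-homogeneous-suc : ∀ {x} i {d} → Homogeneous d (x * pow R (t i) d) →
                          Homogeneous (suc d) (x * pow R (t i) (suc d))
  x*pow-homogeneous-suc i h∈ = resp (x∙yz≈y∙xz _ _ _) (var* i h∈)

  homogeneous⇒scaled : ∀ {ϖinv L} → (∀ j → t j ∈ ScaledR₀ R R₀ ϖinv L) →
                       ∀ {e h} → Homogeneous e h → h ∈ ScaledR₀ R R₀ ϖinv (e ℕ.* L)
  homogeneous⇒scaled {ϖinv} {L} t∈ = go
    where
    open Scaling R ϖinv
    go : ∀ {e h} → Homogeneous e h → h ∈ ScaledR₀ R R₀ ϖinv (e ℕ.* L)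
    go (scalar a∈R₀)            = scaled-0 a∈R₀
    go (var* {e} j h∈)          = scaled-* times {L} {e ℕ.* L} (t∈ j) (go h∈)
    go zero-closed              = 0# , zero' , sym (zeroʳ _)
    go (+-closed {e} a∈ b∈)     = scaled-+ plus {e ℕ.* L} (go a∈) (go b∈)
    go (R₀*-closed {e} a∈R₀ h∈) = scaled-* times {0} {e ℕ.* L} (scaled-0 a∈R₀) (go h∈)
    go (resp {e} a≈b h∈)        = scaled-resp {N = e ℕ.* L} a≈b (go h∈)

  preimages⇒stabilises : ∀ {x} → (∀ i → x ∈ Preimage R R₀ t i) → ∃ λ D → Stabilises x D
  preimages⇒stabilises x∈preimages =
    suc (n ℕ.* d) , stabilises-above xtᵢᵈ∈ (ℕₚ.n<1+n _)
    where
    open Σ (common-witness n _ x*pow-homogeneous-suc (λ i → preimage⇒homogeneous i (x∈preimages i)))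
      renaming (proj₁ to d; proj₂ to xtᵢᵈ∈)

  module _ {ϖ ϖinv : Carrier} (ϖ∈R₀ : ϖ ∈ R₀) (ϖϖinv≈1 : ϖ * ϖinv ≈ 1#)
           (R⊆R₀[1/ϖ] : ∀ r → ∃ λ N → r ∈ ScaledR₀ R R₀ ϖinv N) where
    open Scaling R ϖinv

    1∈A[1/ϖ] : (∃ λ (s : Vector Carrier n) → sumᶠ R n (λ j → s j * t j) ≈ 1#) →
               ∀ D → 1# ∈ Homogeneous D [1/ϖ]
    1∈A[1/ϖ] (s , Σsⱼtⱼ≈1) D =
      [1/ϖ]-resp (pow-1# D) ([1/ϖ]-pow Homogeneous (scalar one) homogeneous-*
        ([1/ϖ]-resp Σsⱼtⱼ≈1 ([1/ϖ]-sumᶠ ϖϖinv≈1 (R₀*-closed ϖ∈R₀) +-closed zero-closed n _ sⱼtⱼ∈)) D)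
      where
      sⱼtⱼ∈ : ∀ j → s j * t j ∈ Homogeneous 1 [1/ϖ]
      sⱼtⱼ∈ j = [1/ϖ]-* R₀*-closed (R⊆R₀[1/ϖ] (s j)) (0 , scaled-0 (homogeneous-t j))

    stabilises⇒power-bounded : ∀ {x D} → Stabilises x D → 1# ∈ Homogeneous D [1/ϖ] →
                                x ∈ PowerBounded R R₀ ϖinv
    stabilises⇒power-bounded {x} {D} x-stabilises (N , 1∈ϖ⁻ᴺA_D) =
      N ℕ.+ D ℕ.* L , λ m →
        scaled-scaled {M = D ℕ.* L} {N = N} (scaled-resp {N = N} (*-identityʳ _)
          (scaled-map (homogeneous⇒scaled {ϖinv} {L} tⱼ∈ϖ⁻ᴸR₀ ∘ stabilises-pow x-stabilises m) {N} 1∈ϖ⁻ᴺA_D))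
      where
      open Σ (common-witness n (λ j L → t j ∈ ScaledR₀ R R₀ ϖinv L)
                (λ j {L} → scaled-suc ϖϖinv≈1 (times ϖ∈R₀) {L}) (R⊆R₀[1/ϖ] ∘ t))
        renaming (proj₁ to L; proj₂ to tⱼ∈ϖ⁻ᴸR₀)

lemma3 : {c ℓ p : Level} (R : CommutativeRing c ℓ) →
         let open CommutativeRing R in
         (R₀ : Pred Carrier p) → IsSubring R R₀ →
         (ϖ ϖinv : Carrier) → ϖ ∈ R₀ → ϖ * ϖinv ≈ 1# →
         ((r : Carrier) → Σ ℕ λ N → Σ Carrier λ a → a ∈ R₀ × (r ≈ pow R ϖinv N * a)) →
         (n : ℕ) (t : Fin n → Carrier) →
         (Σ (Fin n → Carrier) λ s → sumᶠ R n (λ j → s j * t j) ≈ 1#) →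
         (x : Carrier) → ((i : Fin n) → x ∈ Preimage R R₀ t i) →
         x ∈ PowerBounded R R₀ ϖinv
lemma3 R R₀ R₀-subring ϖ ϖinv ϖ∈R₀ ϖϖinv≈1 R⊆R₀[1/ϖ] n t unit x x∈preimages =
  stabilises⇒power-bounded ϖ∈R₀ ϖϖinv≈1 R⊆R₀[1/ϖ] x-stabilises
    (1∈A[1/ϖ] ϖ∈R₀ ϖϖinv≈1 R⊆R₀[1/ϖ] unit D)
  where
  open HomogeneousComponents R R₀-subring t
  open Σ (preimages⇒stabilises x∈preimages) renaming (proj₁ to D; proj₂ to x-stabilises)
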